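{- For all $\sigma_1,\sigma_2\in S(132)$, $\mathrm{crs}(\sigma_1\otimes\sigma_2)=\mathrm{crs}(\sigma_1)+\mathrm{crs}(\sigma_2)$.
   Context: $S(132)=\bigcup_n S_n(132)$ (permutations avoiding the pattern $132$). A crossing of a permutation $\sigma$ is a pair $(i,j)$ with $i<j<\sigma(i)<\sigma(j)$ or $\sigma(i)<\sigma(j)\le i<j$; $\mathrm{crs}(\sigma)$ is the number of crossings. For a permutation $\sigma$ and integers $a,b$: $\sigma^{+a}$ adds $a$ to every entry; $\sigma^{a\rtimes b}$ adds $b$ to every entry $\ge a$; $\sigma(x\ldots y)=\sigma(x)\cdots\sigma(y)$; a dot denotes concatenation. For $\beta\in S_n$, $T(\beta)=\{i\in[n]:\beta^{ -1}(i)>i\text{ and }\beta(i)>i\}$. For $\alpha\in S_m(132)$, $\beta\in S_n(132)$ and $k=1+|T(\beta)|$, $\alpha\otimes\beta=\beta^{k\rtimes m}(1\ldots k-1).\alpha^{+(k-1)}.\beta^{k\rtimes m}(k\ldots n)$. -}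

module Defs where

open import Data.Nat using (ℕ; zero; suc; _+_; _∸_; _<_; _<ᵇ_; _≤ᵇ_)
open import Data.Bool using (Bool; true; false; if_then_else_; _∧_; _∨_)
open import Data.List using (List; []; _∷_; map; length; upTo; take; drop; _++_)
open import Data.Nat.ListAction using (sum)
open import Data.List.Relation.Binary.Permutation.Propositional using (_↭_)
open import Data.Product using (Σ; _×_)
open import Relation.Nullary using (¬_)

-- Permutations are represented in one-line notation as lists of naturals:
-- σ ∈ S_n  is the list  σ(1) ∷ σ(2) ∷ … ∷ σ(n) ∷ [] .

[1‥_] : ℕ → List ℕ
[1‥ n ] = map suc (upTo n)

IsPerm : List ℕ → Set
IsPerm σ = σ ↭ [1‥ length σ ]

-- 1-indexed evaluation σ(i) (0 outside the range [1, n])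
at : List ℕ → ℕ → ℕ
at []       _             = 0
at (x ∷ xs) zero          = 0
at (x ∷ xs) (suc zero)    = x
at (x ∷ xs) (suc (suc i)) = at xs (suc i)

-- 1-indexed position of value v, i.e. σ⁻¹(v) (0 if absent)
pos : List ℕ → ℕ → ℕ
pos []       v = 0
pos (x ∷ xs) v with x Data.Nat.≡ᵇ v
... | true  = 1
... | false with pos xs v
...   | zero  = 0
...   | suc p = suc (suc p)

Avoids132 : List ℕ → Set
Avoids132 σ = ∀ i j k → 1 Data.Nat.≤ i → i < j → j < k → k Data.Nat.≤ length σ →
  ¬ ((at σ i < at σ k) × (at σ k < at σ j))

InS132 : List ℕ → Set
InS132 σ = IsPerm σ × Avoids132 σ

isCrossing : List ℕ → ℕ → ℕ → Bool
isCrossing σ i j =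
  ((i <ᵇ j) ∧ (j <ᵇ at σ i) ∧ (at σ i <ᵇ at σ j)) ∨
  ((at σ i <ᵇ at σ j) ∧ (at σ j ≤ᵇ i) ∧ (i <ᵇ j))

count : (ℕ → Bool) → List ℕ → ℕ
count p xs = sum (map (λ x → if p x then 1 else 0) xs)

crs : List ℕ → ℕ
crs σ = sum (map (λ i → count (isCrossing σ i) [1‥ length σ ]) [1‥ length σ ])

shift : ℕ → List ℕ → List ℕ
shift a = map (λ x → x + a)

bump : ℕ → ℕ → List ℕ → List ℕ
bump a b = map (λ x → if a ≤ᵇ x then x + b else x)

-- σ(x…y) = σ(x)⋯σ(y)  (1-indexed, inclusive)
segment : List ℕ → ℕ → ℕ → List ℕ
segment σ x y = take (suc y ∸ x) (drop (x ∸ 1) σ)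

cardT : List ℕ → ℕ
cardT β = count (λ i → (i <ᵇ pos β i) ∧ (i <ᵇ at β i)) [1‥ length β ]

_⊗_ : List ℕ → List ℕ → List ℕ
α ⊗ β = segment β' 1 (k ∸ 1) ++ (shift (k ∸ 1) α ++ segment β' k n)
  where
    m = length α
    n = length β
    k = suc (cardT β)
    β' = bump k m β

module Submission where

-- With p = |T(β)|, m = |α|, n = |β|, the permutation α ⊗ β is the insertion
-- insertAt p α β: positions and values of β are relabelled by the strictly
-- monotone map x ↦ x (x ≤ p), x ↦ x + m (x > p), and α^{+p} fills the block
-- (p, p+m] of positions and of values.  We prove crs (insertAt p α β) =
-- crs α + crs β for every p ≤ n and every α with values in [1, m]; neither
-- 132-avoidance nor the special value p = |T(β)| is needed.
--
-- Plan: (1) write crs σ as a double sum of crossing indicators over positions;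
-- (2) the crossing test only compares i, j, σ(i), σ(j), so it is invariant
-- under strictly monotone relabelling, and an arc inside the block never
-- crosses an arc outside it; (3) the positions 1 … n+m are the relabelled
-- positions of β together with the block, which splits the double sum into
-- four parts; (4) these parts are crs β, 0, 0 and crs α.

open import Defs
open import Data.Nat using (ℕ; zero; suc; _+_; _∸_; _<_; _≤_; _<ᵇ_; _≤ᵇ_; z≤n; s≤s; z<s; s<s; _⊓_)
open import Data.Nat.Properties
open import Data.Bool using (Bool; true; false; if_then_else_; _∧_; _∨_; T)
open import Data.Bool.Properties using (T-∧; T-∨)
open import Data.Unit using (tt)
open import Data.Empty using (⊥-elim)
open import Data.Sum using (_⊎_; inj₁; inj₂)
open import Data.Product using (_×_; _,_; proj₁; proj₂)
open import Data.List using (List; []; _∷_; map; length; upTo; take; drop; _++_; applyUpTo)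
open import Data.List.Properties using (length-map; length-++; length-take; length-drop; length-upTo; take-all; map-∘)
open import Data.Nat.ListAction using (sum)
open import Data.List.Membership.Propositional using (_∈_)
open import Data.List.Membership.Propositional.Properties using (∈-map⁻; ∈-upTo⁻)
open import Data.List.Relation.Binary.Permutation.Propositional.Properties using (∈-resp-↭)
open import Data.List.Relation.Unary.Any using (here; there)
open import Relation.Nullary using (¬_; yes; no)
open import Relation.Nullary.Reflects using (det; fromEquivalence)
open import Relation.Binary.Core using (_Preserves_⟶_)
open import Relation.Binary.PropositionalEquality
open import Function using (_∘_; id; Equivalence)
open import Algebra.Properties.CommutativeSemigroup +-commutativeSemigroup using (interchange; x∙yz≈xz∙y)

sumBelow : ℕ → (ℕ → ℕ) → ℕ
sumBelow zero    f = 0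
sumBelow (suc n) f = f 0 + sumBelow n (f ∘ suc)

sumBelow-cong : ∀ n {f g : ℕ → ℕ} → (∀ i → i < n → f i ≡ g i) → sumBelow n f ≡ sumBelow n g
sumBelow-cong zero    eq = refl
sumBelow-cong (suc n) eq = cong₂ _+_ (eq 0 z<s) (sumBelow-cong n (λ i i<n → eq (suc i) (s<s i<n)))

sumBelow-zero : ∀ n {f : ℕ → ℕ} → (∀ i → i < n → f i ≡ 0) → sumBelow n f ≡ 0
sumBelow-zero zero    eq = refl
sumBelow-zero (suc n) eq rewrite eq 0 z<s = sumBelow-zero n (λ i i<n → eq (suc i) (s<s i<n))

sumBelow-+ : ∀ a b (f : ℕ → ℕ) → sumBelow (a + b) f ≡ sumBelow a f + sumBelow b (λ i → f (a + i))
sumBelow-+ zero    b f = refl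
sumBelow-+ (suc a) b f = trans (cong (f 0 +_) (sumBelow-+ a b (f ∘ suc))) (sym (+-assoc (f 0) _ _))

sumBelow-distrib : ∀ n (f g : ℕ → ℕ) → sumBelow n (λ i → f i + g i) ≡ sumBelow n f + sumBelow n g
sumBelow-distrib zero    f g = refl
sumBelow-distrib (suc n) f g =
  trans (cong (f 0 + g 0 +_) (sumBelow-distrib n (f ∘ suc) (g ∘ suc))) (interchange (f 0) (g 0) _ _)

sum-applyUpTo : ∀ n (g f : ℕ → ℕ) → sum (map g (applyUpTo f n)) ≡ sumBelow n (g ∘ f)
sum-applyUpTo zero    g f = refl
sum-applyUpTo (suc n) g f = cong (g (f 0) +_) (sum-applyUpTo n g (f ∘ suc))

sum-[1‥] : ∀ n (g : ℕ → ℕ) → sum (map g [1‥ n ]) ≡ sumBelow n (g ∘ suc)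
sum-[1‥] n g = trans (cong sum (sym (map-∘ (upTo n)))) (sum-applyUpTo n (g ∘ suc) id)

indicator : Bool → ℕ
indicator b = if b then 1 else 0

indicator-false : ∀ {b} → ¬ T b → indicator b ≡ 0
indicator-false {false} _  = refl
indicator-false {true}  ¬t = ⊥-elim (¬t tt)

cross : List ℕ → ℕ → ℕ → ℕ
cross σ i j = indicator (isCrossing σ i j)

crs-as-sum : ∀ σ → crs σ ≡ sumBelow (length σ) λ i → sumBelow (length σ) λ j → cross σ (suc i) (suc j)
crs-as-sum σ = trans (sum-[1‥] n _) (sumBelow-cong n (λ i _ → sum-[1‥] n (cross σ (suc i))))
  where n = length σ

crossingTest : ℕ → ℕ → ℕ → ℕ → Bool
crossingTest i j a b = ((i <ᵇ j) ∧ (j <ᵇ a) ∧ (a <ᵇ b)) ∨ ((a <ᵇ b) ∧ (b ≤ᵇ i) ∧ (i <ᵇ j))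

Crosses : ℕ → ℕ → ℕ → ℕ → Set
Crosses i j a b = (i < j × j < a × a < b) ⊎ (a < b × b ≤ i × i < j)

crossingTest-sound : ∀ i j a b → T (crossingTest i j a b) → Crosses i j a b
crossingTest-sound i j a b t with Equivalence.to T-∨ t
... | inj₁ t₁ = let (ij , t₂) = Equivalence.to T-∧ t₁ ; (ja , ab) = Equivalence.to T-∧ t₂
                in inj₁ (<ᵇ⇒< i j ij , <ᵇ⇒< j a ja , <ᵇ⇒< a b ab)
... | inj₂ t₁ = let (ab , t₂) = Equivalence.to T-∧ t₁ ; (bi , ij) = Equivalence.to T-∧ t₂
                in inj₂ (<ᵇ⇒< a b ab , ≤ᵇ⇒≤ b i bi , <ᵇ⇒< i j ij)

-- Invariance of the crossing test under strictly monotone relabellings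

StrictlyMonotone : (ℕ → ℕ) → Set
StrictlyMonotone h = h Preserves _<_ ⟶ _<_

module Monotone {h : ℕ → ℕ} (mono : StrictlyMonotone h) where

  monotone : h Preserves _≤_ ⟶ _≤_
  monotone x≤y with m≤n⇒m<n∨m≡n x≤y
  ... | inj₁ x<y  = <⇒≤ (mono x<y)
  ... | inj₂ refl = ≤-refl

  reflects-< : ∀ {x y} → h x < h y → x < y
  reflects-< hx<hy = ≰⇒> (λ y≤x → <⇒≱ hx<hy (monotone y≤x))

  reflects-≤ : ∀ {x y} → h x ≤ h y → x ≤ y
  reflects-≤ hx≤hy = ≮⇒≥ (λ y<x → <⇒≱ (mono y<x) hx≤hy)

  -- Both boolean comparisons reflect the same proposition about x and y.
  <ᵇ-invariant : ∀ x y → (h x <ᵇ h y) ≡ (x <ᵇ y)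
  <ᵇ-invariant x y =
    det (fromEquivalence (reflects-< ∘ <ᵇ⇒< _ _) (<⇒<ᵇ ∘ mono)) (<ᵇ-reflects-< x y)

  ≤ᵇ-invariant : ∀ x y → (h x ≤ᵇ h y) ≡ (x ≤ᵇ y)
  ≤ᵇ-invariant x y =
    det (fromEquivalence (reflects-≤ ∘ ≤ᵇ⇒≤ _ _) (≤⇒≤ᵇ ∘ monotone)) (≤ᵇ-reflects-≤ x y)

  crossingTest-invariant : ∀ i j a b → crossingTest (h i) (h j) (h a) (h b) ≡ crossingTest i j a b
  crossingTest-invariant i j a b
    rewrite <ᵇ-invariant i j | <ᵇ-invariant j a | <ᵇ-invariant a b | ≤ᵇ-invariant b i = refl

  cross-relabel : ∀ σ τ i j → at τ (h i) ≡ h (at σ i) → at τ (h j) ≡ h (at σ j) →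
                  cross τ (h i) (h j) ≡ cross σ i j
  cross-relabel σ τ i j τi τj = cong indicator
    (trans (cong₂ (crossingTest (h i) (h j)) τi τj) (crossingTest-invariant i j (at σ i) (at σ j)))

-- No crossings across a block of consecutive values

Inside : ℕ → ℕ → ℕ → Set
Inside p m x = p < x × x ≤ p + m

Outside : ℕ → ℕ → ℕ → Set
Outside p m x = x ≤ p ⊎ p + m < x

inside-convex : ∀ {p m x y z} → Inside p m x → Inside p m z → x ≤ y → y ≤ z → ¬ Outside p m y
inside-convex (p<x , _) _ x≤y _ (inj₁ y≤p)    = <⇒≱ (<-≤-trans p<x x≤y) y≤p
inside-convex _ (_ , z≤p+m) _ y≤z (inj₂ p+m<y) = <⇒≱ p+m<y (≤-trans y≤z z≤p+m)

-- An arc i ↦ a inside the block never crosses an arc j ↦ b outside it: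
-- a crossing would put an endpoint of the outer arc between i and a.
no-crossing-across : ∀ {p m i j a b} → Inside p m i → Inside p m a → Outside p m j → Outside p m b →
                     ¬ Crosses i j a b × ¬ Crosses j i b a
no-crossing-across {i = i} {j} {a} {b} ii ia oj ob = inner-outer , outer-inner
  where
    inner-outer : ¬ Crosses i j a b
    inner-outer (inj₁ (i<j , j<a , _))  = inside-convex ii ia (<⇒≤ i<j) (<⇒≤ j<a) oj
    inner-outer (inj₂ (a<b , b≤i , _))  = inside-convex ia ii (<⇒≤ a<b) b≤i ob
    outer-inner : ¬ Crosses j i b a
    outer-inner (inj₁ (_ , i<b , b<a))  = inside-convex ii ia (<⇒≤ i<b) (<⇒≤ b<a) ob
    outer-inner (inj₂ (_ , a≤j , j<i))  = inside-convex ia ii a≤j (<⇒≤ j<i) oj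

bumpValue : ℕ → ℕ → ℕ → ℕ
bumpValue a b x = if a ≤ᵇ x then x + b else x

-- Positions (and values) of β are relabelled by slot; α occupies the block
-- positions block 0, …, block (m-1), i.e. p+1, …, p+m.
module Interleaving (p m : ℕ) where

  slot : ℕ → ℕ
  slot = bumpValue (suc p) m

  block : ℕ → ℕ
  block a = suc (p + a)

  slot-cases : ∀ x → (x ≤ p × slot x ≡ x) ⊎ (p < x × slot x ≡ x + m)
  slot-cases x with suc p ≤ᵇ x in e
  ... | true  = inj₂ (≤ᵇ⇒≤ (suc p) x (subst T (sym e) tt) , refl)
  ... | false = inj₁ (≮⇒≥ (λ p<x → subst T e (≤⇒≤ᵇ p<x)) , refl)

  slot-low : ∀ u → u < p → slot (suc u) ≡ suc u
  slot-low u u<p with slot-cases (suc u)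
  ... | inj₁ (_ , eq)    = eq
  ... | inj₂ (p<1+u , _) = ⊥-elim (<⇒≱ u<p (≤-pred p<1+u))

  slot-high : ∀ v → slot (suc (p + v)) ≡ suc (p + (m + v))
  slot-high v with slot-cases (suc (p + v))
  ... | inj₁ (1+p+v≤p , _) = ⊥-elim (<⇒≱ (s≤s (m≤m+n p v)) 1+p+v≤p)
  ... | inj₂ (_ , eq)      = trans eq (cong suc (trans (+-assoc p v m) (cong (p +_) (+-comm v m))))

  slot-mono : StrictlyMonotone slot
  slot-mono {x} {y} x<y with slot-cases x | slot-cases y
  ... | inj₁ (_ , ex) | inj₁ (_ , ey)   rewrite ex | ey = x<y
  ... | inj₁ (_ , ex) | inj₂ (_ , ey)   rewrite ex | ey = <-≤-trans x<y (m≤m+n y m)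
  ... | inj₂ (p<x , _) | inj₁ (y≤p , _) = ⊥-elim (<-asym p<x (<-≤-trans x<y y≤p))
  ... | inj₂ (_ , ex) | inj₂ (_ , ey)   rewrite ex | ey = +-monoˡ-< m x<y

  slot-outside : ∀ x → Outside p m (slot x)
  slot-outside x with slot-cases x
  ... | inj₁ (x≤p , ex) rewrite ex = inj₁ x≤p
  ... | inj₂ (p<x , ex) rewrite ex = inj₂ (+-monoˡ-< m p<x)

  block-inside : ∀ a → a < m → Inside p m (block a)
  block-inside a a<m = s≤s (m≤m+n p a) , subst (_≤ p + m) (+-suc p a) (+-monoʳ-≤ p a<m)

  interleave : ∀ n → p ≤ n → ∀ (G : ℕ → ℕ) →
               sumBelow (p + (m + (n ∸ p))) (G ∘ suc) ≡
               sumBelow n (λ u → G (slot (suc u))) + sumBelow m (G ∘ block)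
  interleave n p≤n G = begin
    sumBelow (p + (m + q)) (G ∘ suc)       ≡⟨ sumBelow-+ p (m + q) (G ∘ suc) ⟩
    low + sumBelow (m + q) (G ∘ block)     ≡⟨ cong (low +_) (sumBelow-+ m q (G ∘ block)) ⟩
    low + (inner + high)                   ≡⟨ x∙yz≈xz∙y low inner high ⟩
    low + high + inner                     ≡⟨ cong (_+ inner) (sym slots) ⟩
    sumBelow n (λ u → G (slot (suc u))) + inner ∎
    where
      open ≡-Reasoning
      q = n ∸ p
      low = sumBelow p (G ∘ suc)
      inner = sumBelow m (G ∘ block)
      high = sumBelow q (λ v → G (suc (p + (m + v))))
      slots : sumBelow n (λ u → G (slot (suc u))) ≡ low + high
      slots = begin
        sumBelow n (λ u → G (slot (suc u)))
          ≡⟨ cong (λ k → sumBelow k (λ u → G (slot (suc u)))) (sym (m+[n∸m]≡n p≤n)) ⟩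
        sumBelow (p + q) (λ u → G (slot (suc u)))
          ≡⟨ sumBelow-+ p q _ ⟩
        sumBelow p (λ u → G (slot (suc u))) + sumBelow q (λ v → G (slot (suc (p + v))))
          ≡⟨ cong₂ _+_ (sumBelow-cong p (λ u u<p → cong G (slot-low u u<p)))
                       (sumBelow-cong q (λ v _ → cong G (slot-high v))) ⟩
        low + high ∎

  interleave² : ∀ n → p ≤ n → ∀ (G : ℕ → ℕ → ℕ) → let N = p + (m + (n ∸ p)) in
    sumBelow N (λ i → sumBelow N λ j → G (suc i) (suc j)) ≡
      (sumBelow n (λ u → sumBelow n λ v → G (slot (suc u)) (slot (suc v))) +
       sumBelow m (λ a → sumBelow n λ v → G (block a) (slot (suc v)))) +
      (sumBelow n (λ u → sumBelow m λ b → G (slot (suc u)) (block b)) +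
       sumBelow m (λ a → sumBelow m λ b → G (block a) (block b)))
  interleave² n p≤n G = begin
    sumBelow N (λ i → sumBelow N λ j → G (suc i) (suc j))
      ≡⟨ sumBelow-cong N (λ i _ → interleave n p≤n (G (suc i))) ⟩
    sumBelow N (λ i → toSlots (suc i) + toBlock (suc i))
      ≡⟨ sumBelow-distrib N (toSlots ∘ suc) (toBlock ∘ suc) ⟩
    sumBelow N (toSlots ∘ suc) + sumBelow N (toBlock ∘ suc)
      ≡⟨ cong₂ _+_ (interleave n p≤n toSlots) (interleave n p≤n toBlock) ⟩
    _ ∎
    where
      open ≡-Reasoning
      N = p + (m + (n ∸ p))
      toSlots toBlock : ℕ → ℕ
      toSlots x = sumBelow n λ v → G x (slot (suc v))
      toBlock x = sumBelow m λ b → G x (block b)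

-- Evaluating lists built from pieces (positions are 1-based: at xs (suc i) is the (i+1)-st entry)

at-++ˡ : ∀ (xs ys : List ℕ) i → i < length xs → at (xs ++ ys) (suc i) ≡ at xs (suc i)
at-++ˡ (x ∷ xs) ys zero    _         = refl
at-++ˡ (x ∷ xs) ys (suc i) (s≤s i<n) = at-++ˡ xs ys i i<n

at-++ʳ : ∀ (xs ys : List ℕ) i → at (xs ++ ys) (suc (length xs + i)) ≡ at ys (suc i)
at-++ʳ []       ys i = refl
at-++ʳ (x ∷ xs) ys i = at-++ʳ xs ys i

at-map : ∀ (g : ℕ → ℕ) (xs : List ℕ) i → i < length xs → at (map g xs) (suc i) ≡ g (at xs (suc i))
at-map g (x ∷ xs) zero    _         = refl
at-map g (x ∷ xs) (suc i) (s≤s i<n) = at-map g xs i i<n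

at-take : ∀ p (xs : List ℕ) i → i < p → at (take p xs) (suc i) ≡ at xs (suc i)
at-take (suc p) []       i       _         = refl
at-take (suc p) (x ∷ xs) zero    _         = refl
at-take (suc p) (x ∷ xs) (suc i) (s≤s i<p) = at-take p xs i i<p

at-drop : ∀ p (xs : List ℕ) i → at (drop p xs) (suc i) ≡ at xs (suc (p + i))
at-drop zero    xs       i = refl
at-drop (suc p) []       i = refl
at-drop (suc p) (x ∷ xs) i = at-drop p xs i

at-∈ : ∀ (xs : List ℕ) i → i < length xs → at xs (suc i) ∈ xs
at-∈ (x ∷ xs) zero    _         = here refl
at-∈ (x ∷ xs) (suc i) (s≤s i<n) = there (at-∈ xs i i<n)

perm-values : ∀ α → IsPerm α → ∀ a → a < length α → Inside 0 (length α) (at α (suc a))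
perm-values α α-perm a a<m with ∈-map⁻ suc (∈-resp-↭ α-perm (at-∈ α a a<m))
... | w , w∈ , eq rewrite eq = s≤s z≤n , ∈-upTo⁻ w∈

insertAt : ℕ → List ℕ → List ℕ → List ℕ
insertAt p α β = take p β' ++ (shift p α ++ drop p β')
  where β' = bump (suc p) (length α) β

module InsertionCrossings (p : ℕ) (α β : List ℕ) (p≤n : p ≤ length β)
                          (α-values : ∀ a → a < length α → Inside 0 (length α) (at α (suc a))) where
  m = length α
  n = length β
  open Interleaving p m

  β' = bump (suc p) m β
  σ  = insertAt p α β

  p+v<n : ∀ v → v < n ∸ p → p + v < n
  p+v<n v v<q = subst (p + v <_) (m+[n∸m]≡n p≤n) (+-monoʳ-< p v<q)

  length-take-β' : length (take p β') ≡ p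
  length-take-β' = trans (length-take p β') (trans (cong (p ⊓_) (length-map slot β)) (m≤n⇒m⊓n≡m p≤n))

  length-insertAt : length σ ≡ p + (m + (n ∸ p))
  length-insertAt = trans (length-++ (take p β'))
    (cong₂ _+_ length-take-β'
      (trans (length-++ (shift p α)) (cong₂ _+_ (length-map _ α)
        (trans (length-drop p β') (cong (_∸ p) (length-map slot β))))))

  at-after-prefix : ∀ i → at σ (suc (p + i)) ≡ at (shift p α ++ drop p β') (suc i)
  at-after-prefix i = trans (cong (λ k → at σ (suc (k + i))) (sym length-take-β'))
                            (at-++ʳ (take p β') _ i)

  at-slot : ∀ u → u < n → at σ (slot (suc u)) ≡ slot (at β (suc u))
  at-slot u u<n with u <? p
  ... | yes u<p = begin
    at σ (slot (suc u))  ≡⟨ cong (at σ) (slot-low u u<p) ⟩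
    at σ (suc u)         ≡⟨ at-++ˡ (take p β') _ u (subst (u <_) (sym length-take-β') u<p) ⟩
    at (take p β') (suc u) ≡⟨ at-take p β' u u<p ⟩
    at β' (suc u)        ≡⟨ at-map slot β u u<n ⟩
    slot (at β (suc u))  ∎
    where open ≡-Reasoning
  ... | no u≮p = begin
    at σ (slot (suc u))                       ≡⟨ cong (λ k → at σ (slot (suc k))) (sym p+v≡u) ⟩
    at σ (slot (suc (p + v)))                 ≡⟨ cong (at σ) (slot-high v) ⟩
    at σ (suc (p + (m + v)))                  ≡⟨ at-after-prefix (m + v) ⟩
    at (shift p α ++ drop p β') (suc (m + v)) ≡⟨ cong (λ k → at (shift p α ++ drop p β') (suc (k + v)))
                                                      (sym (length-map _ α)) ⟩
    at (shift p α ++ drop p β') (suc (length (shift p α) + v)) ≡⟨ at-++ʳ (shift p α) _ v ⟩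
    at (drop p β') (suc v)                    ≡⟨ at-drop p β' v ⟩
    at β' (suc (p + v))                       ≡⟨ at-map slot β (p + v) (subst (_< n) (sym p+v≡u) u<n) ⟩
    slot (at β (suc (p + v)))                 ≡⟨ cong (λ k → slot (at β (suc k))) p+v≡u ⟩
    slot (at β (suc u))                       ∎
    where
      open ≡-Reasoning
      v = u ∸ p
      p+v≡u : p + v ≡ u
      p+v≡u = m+[n∸m]≡n (≮⇒≥ u≮p)

  at-block : ∀ a → a < m → at σ (block a) ≡ at α (suc a) + p
  at-block a a<m = begin
    at σ (suc (p + a))                   ≡⟨ at-after-prefix a ⟩
    at (shift p α ++ drop p β') (suc a)  ≡⟨ at-++ˡ (shift p α) _ a (subst (a <_) (sym (length-map _ α)) a<m) ⟩
    at (shift p α) (suc a)               ≡⟨ at-map (_+ p) α a a<m ⟩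
    at α (suc a) + p                     ∎
    where open ≡-Reasoning

  block-value-inside : ∀ a → a < m → Inside p m (at α (suc a) + p)
  block-value-inside a a<m =
    let (0<x , x≤m) = α-values a a<m
    in subst (p <_) (+-comm p _) (m<m+n p 0<x) , subst (_≤ p + m) (+-comm p _) (+-monoʳ-≤ p x≤m)

  cross-slots : ∀ u v → u < n → v < n → cross σ (slot (suc u)) (slot (suc v)) ≡ cross β (suc u) (suc v)
  cross-slots u v u<n v<n = Monotone.cross-relabel slot-mono β σ (suc u) (suc v) (at-slot u u<n) (at-slot v v<n)

  cross-blocks : ∀ a b → a < m → b < m → cross σ (block a) (block b) ≡ cross α (suc a) (suc b)
  cross-blocks a b a<m b<m =
    trans (cong₂ (cross σ) (shifted a) (shifted b))
          (Monotone.cross-relabel (λ x<y → +-monoˡ-< p x<y) α σ (suc a) (suc b)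
            (trans (cong (at σ) (sym (shifted a))) (at-block a a<m))
            (trans (cong (at σ) (sym (shifted b))) (at-block b b<m)))
    where
      shifted : ∀ x → block x ≡ suc x + p
      shifted x = cong suc (+-comm p x)

  cross-block-slot : ∀ a v → a < m → v < n →
                     cross σ (block a) (slot (suc v)) ≡ 0 × cross σ (slot (suc v)) (block a) ≡ 0
  cross-block-slot a v a<m v<n =
    let (¬block-slot , ¬slot-block) =
          no-crossing-across (block-inside a a<m) (block-value-inside a a<m)
                             (slot-outside (suc v)) (slot-outside (at β (suc v)))
        values = cong₂ (crossingTest (block a) (slot (suc v))) (at-block a a<m) (at-slot v v<n)
        values′ = cong₂ (crossingTest (slot (suc v)) (block a)) (at-slot v v<n) (at-block a a<m)
    in indicator-false (¬block-slot ∘ crossingTest-sound _ _ _ _ ∘ subst T values)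
     , indicator-false (¬slot-block ∘ crossingTest-sound _ _ _ _ ∘ subst T values′)

  crs-insertAt : crs σ ≡ crs α + crs β
  crs-insertAt = begin
    crs σ
      ≡⟨ crs-as-sum σ ⟩
    sumBelow (length σ) (λ i → sumBelow (length σ) λ j → cross σ (suc i) (suc j))
      ≡⟨ cong (λ N → sumBelow N (λ i → sumBelow N λ j → cross σ (suc i) (suc j))) length-insertAt ⟩
    _ ≡⟨ interleave² n p≤n (cross σ) ⟩
    (slots-slots + blocks-slots) + (slots-blocks + blocks-blocks)
      ≡⟨ cong₂ _+_ (cong₂ _+_ β-part mixed₁) (cong₂ _+_ mixed₂ α-part) ⟩
    (crs β + 0) + (0 + crs α)
      ≡⟨ cong (_+ crs α) (+-identityʳ (crs β)) ⟩
    crs β + crs α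
      ≡⟨ +-comm (crs β) (crs α) ⟩
    crs α + crs β ∎
    where
      open ≡-Reasoning
      slots-slots = sumBelow n (λ u → sumBelow n λ v → cross σ (slot (suc u)) (slot (suc v)))
      blocks-slots = sumBelow m (λ a → sumBelow n λ v → cross σ (block a) (slot (suc v)))
      slots-blocks = sumBelow n (λ u → sumBelow m λ b → cross σ (slot (suc u)) (block b))
      blocks-blocks = sumBelow m (λ a → sumBelow m λ b → cross σ (block a) (block b))
      β-part : slots-slots ≡ crs β
      β-part = trans (sumBelow-cong n λ u u<n → sumBelow-cong n λ v v<n → cross-slots u v u<n v<n)
                     (sym (crs-as-sum β))
      α-part : blocks-blocks ≡ crs α
      α-part = trans (sumBelow-cong m λ a a<m → sumBelow-cong m λ b b<m → cross-blocks a b a<m b<m)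
                     (sym (crs-as-sum α))
      mixed₁ : blocks-slots ≡ 0
      mixed₁ = sumBelow-zero m λ a a<m → sumBelow-zero n λ v v<n → proj₁ (cross-block-slot a v a<m v<n)
      mixed₂ : slots-blocks ≡ 0
      mixed₂ = sumBelow-zero n λ u u<n → sumBelow-zero m λ b b<m → proj₂ (cross-block-slot b u b<m u<n)

-- |T(β)| ≤ |β|, so p = |T(β)| is an admissible insertion point.
count≤length : ∀ (g : ℕ → Bool) xs → count g xs ≤ length xs
count≤length g []       = z≤n
count≤length g (x ∷ xs) with g x
... | true  = s≤s (count≤length g xs)
... | false = m≤n⇒m≤1+n (count≤length g xs)

cardT≤length : ∀ β → cardT β ≤ length β
cardT≤length β = ≤-trans (count≤length _ [1‥ length β ])
  (≤-reflexive (trans (length-map suc (upTo (length β))) (length-upTo (length β))))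

-- α ⊗ β is the insertion at p = |T(β)|: the final segment β'(p+1…n) is all of drop p β'.
⊗-is-insertAt : ∀ α β → α ⊗ β ≡ insertAt (cardT β) α β
⊗-is-insertAt α β = cong (λ rest → take p β' ++ (shift p α ++ rest))
  (take-all (length β ∸ p) (drop p β')
    (≤-reflexive (trans (length-drop p β') (cong (_∸ p) (length-map _ β)))))
  where
    p = cardT β
    β' = bump (suc p) (length α) β

proposition3p4 : ∀ σ₁ σ₂ → InS132 σ₁ → InS132 σ₂ → crs (σ₁ ⊗ σ₂) ≡ crs σ₁ + crs σ₂
proposition3p4 σ₁ σ₂ (σ₁-perm , _) _ = begin
  crs (σ₁ ⊗ σ₂)                    ≡⟨ cong crs (⊗-is-insertAt σ₁ σ₂) ⟩
  crs (insertAt (cardT σ₂) σ₁ σ₂)  ≡⟨ InsertionCrossings.crs-insertAt (cardT σ₂) σ₁ σ₂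
                                        (cardT≤length σ₂) (perm-values σ₁ σ₁-perm) ⟩
  crs σ₁ + crs σ₂                  ∎
  where open ≡-Reasoning
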